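{- Assume the setting described in the context. For every outcome of $\mathcal{X}$ and every edge $zx\in\mathcal{Y}^*_{\mathcal{X}}$, there is at most one other edge in $\mathcal{Y}^*_{\mathcal{X}}$ that is conflicting with $zx$.
   Context: Let $G=(V,E)$ be a complete graph on $n$ vertices with $n$ divisible by 3, and let $w:E\to\mathbb{R}_{\ge 0}$ satisfy the triangle inequality. Let $\mathcal{C}$ be a cycle packing of $G$ (vertex-disjoint simple cycles of length at least 3 covering all vertices). Fix a constant $0\le\tau\le1/3$. For an edge $xy$ of a cycle $C\in\mathcal{C}$ and a vertex $z\notin C$, the tuple $(x,y;z)$ is a triplet. It is good if $w(xy)\le(1-\tau)(w(xz)+w(yz))$. Let $H$ be the multigraph on $V$ containing, for each good triplet $(x,y;z)$, two edges $xz$ and $yz$. Both edges get augmented weight $w(xz)+w(yz)$ and are labeled by the triplet $(x,y;z)$. Two edges of $H$ are conflicting if their labeling triplets share a common vertex. Let $\mathcal{Y}^*$ be a maximum augmented weight matching of $H$, of arbitrary size. Random matching $\mathcal{X}$: - Set $\mathcal{L}=\mathcal{R}=\emptyset$. - For each even cycle of $\mathcal{C}$, partition its edges into two perfect matchings of the cycle and add a uniformly random one of them to $\mathcal{L}$. - For each odd cycle, delete a uniformly random edge and partition the remaining path into two matchings. Choose one of them uniformly at random, put one uniformly random edge of it into $\mathcal{R}$, and put its other edges into $\mathcal{L}$. - $\mathcal{X}$ consists of a uniformly random subset of $\frac23|\mathcal{L}|$ edges of $\mathcal{L}$, together with all edges of $\mathcal{R}$. $\mathcal{Y}^*_{\mathcal{X}}$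 is the set of edges $zx\in\mathcal{Y}^*$ whose label is a triplet $(x,y;z)$ with $xy\in\mathcal{X}$ and $z$ not covered by $\mathcal{X}$.
   Formalization: The edge weights $w$ and the constant $\tau$ are rational rather than real. -}

module Defs where

open import Data.Nat as ℕ using (ℕ; zero; suc; _≤_)
open import Data.Nat.DivMod using (_%_; _/_; _mod_)
open import Data.Fin using (Fin; toℕ) renaming (zero to fzero; suc to fsuc)
open import Data.Bool using (Bool; true; false; if_then_else_; _∨_)
open import Data.Product using (Σ; ∃; _×_; _,_; proj₁; proj₂)
open import Data.Sum using (_⊎_)
open import Data.Empty using (⊥)
open import Data.List using (List; foldr)
open import Data.List.Membership.Propositional using (_∈_)
open import Data.List.Relation.Unary.All using (All)
open import Data.List.Relation.Unary.AllPairs using (AllPairs)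
open import Data.Rational as ℚ using (ℚ; 0ℚ; 1ℚ)
open import Relation.Binary.PropositionalEquality using (_≡_; _≢_)
open import Relation.Nullary using (¬_)
open import Function.Bundles using (_⇔_)

-- Edge weights on the complete graph K_n (vertices Fin n).
-- Only the values on pairs of distinct vertices are meaningful.

record Weights (n : ℕ) : Set where
  field
    w        : Fin n → Fin n → ℚ
    w-sym    : ∀ x y → w x y ≡ w y x
    w-nonneg : ∀ x y → x ≢ y → 0ℚ ℚ.≤ w x y
    w-tri    : ∀ x y z → x ≢ y → y ≢ z → x ≢ z →
               w x z ℚ.≤ (w x y ℚ.+ w y z)
open Weights public

-- Cycle packing: m cycles, cycle c has len c ≥ 3 vertices
-- vtx c 0, …, vtx c (len c - 1), in cyclic order.  Every vertex of K_n
-- occurs at exactly one position of exactly one cycle.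

next : ∀ {k} → Fin k → Fin k
next {suc k} i = suc (toℕ i) mod suc k

-- cyclic distance from index d to index i in Z/k : (i - d) mod k
cycDist : ∀ {k} → Fin k → Fin k → ℕ
cycDist {suc k} d i = (toℕ i ℕ.+ (suc k ℕ.∸ toℕ d)) % suc k

record CyclePacking (n : ℕ) : Set where
  field
    m     : ℕ
    len   : Fin m → ℕ
    len≥3 : ∀ c → 3 ≤ len c
    vtx   : (c : Fin m) → Fin (len c) → Fin n
  -- positions (c , i); position (c , i) also names the cycle edge
  -- between vtx c i and vtx c (next i)
  Pos : Set
  Pos = Σ (Fin m) (λ c → Fin (len c))
  vertexAt : Pos → Fin n
  vertexAt (c , i) = vtx c i
  field
    vtx-injective : ∀ p q → vertexAt p ≡ vertexAt q → p ≡ q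
    vtx-covers    : ∀ v → ∃ λ p → vertexAt p ≡ v
  endA endB : Pos → Fin n
  endA (c , i) = vtx c i
  endB (c , i) = vtx c (next i)
  OnCycle : Fin n → Fin m → Set
  OnCycle z c = ∃ λ i → vtx c i ≡ z
open CyclePacking public

-- An edge of H is given by a triplet (cycle edge e = xy,
-- apex z) together with a side selecting which of the two edges xz / yz
-- it is (side = true: endA e, side = false: endB e).

record HEdge {n : ℕ} (P : CyclePacking n) : Set where
  constructor hedge
  field
    ce   : Pos P
    apex : Fin n
    side : Bool
open HEdge public

module _ {n : ℕ} (P : CyclePacking n) where

  hend : HEdge P → Fin n
  hend h = if side h then endA P (ce h) else endB P (ce h)

  Ends : HEdge P → Fin n → Set
  Ends h v = v ≡ apex h ⊎ v ≡ hend h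

  InTrip : Fin n → HEdge P → Set
  InTrip v h = v ≡ apex h ⊎ (v ≡ endA P (ce h) ⊎ v ≡ endB P (ce h))

  Conflicting : HEdge P → HEdge P → Set
  Conflicting h h' = ∃ λ v → InTrip v h × InTrip v h'

  module _ (W : Weights n) (τ : ℚ) where

    Good : Pos P → Fin n → Set
    Good e z = w W (endA P e) (endB P e)
               ℚ.≤ ((1ℚ ℚ.- τ) ℚ.* (w W (endA P e) z ℚ.+ w W (endB P e) z))

    ValidH : HEdge P → Set
    ValidH h = ¬ OnCycle P (apex h) (proj₁ (ce h)) × Good (ce h) (apex h)

    augW : HEdge P → ℚ
    augW h = w W (endA P (ce h)) (apex h) ℚ.+ w W (endB P (ce h)) (apex h)

    totalW : List (HEdge P) → ℚ
    totalW = foldr (λ h acc → augW h ℚ.+ acc) 0ℚ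

    IsMatchingH : List (HEdge P) → Set
    IsMatchingH M = All ValidH M ×
                    AllPairs (λ h h' → ∀ v → Ends h v → Ends h' v → ⊥) M

    IsMaxMatchingH : List (HEdge P) → Set
    IsMaxMatchingH M = IsMatchingH M ×
                       (∀ M' → IsMatchingH M' → totalW M' ℚ.≤ totalW M)

countFin : ∀ k → (Fin k → Bool) → ℕ
countFin zero    f = 0
countFin (suc k) f = (if f fzero then 1 else 0) ℕ.+ countFin k (λ i → f (fsuc i))

sumFin : ∀ k → (Fin k → ℕ) → ℕ
sumFin zero    f = 0
sumFin (suc k) f = f fzero ℕ.+ sumFin k (λ i → f (fsuc i))

module _ {n : ℕ} (P : CyclePacking n) where

  countPos : (Pos P → Bool) → ℕ
  countPos f = sumFin (m P) (λ c → countFin (len P c) (λ i → f (c , i)))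

  -- Possible choices for one cycle c, producing its contribution to L and R.
  -- Even cycle: one of the two perfect matchings (edges of index parity b).
  EvenChoice : Fin (m P) → (L R : Pos P → Bool) → Set
  EvenChoice c L R = Σ ℕ λ b → b ℕ.< 2 ×
    (∀ i → (L (c , i) ≡ true ⇔ toℕ i % 2 ≡ b) × R (c , i) ≡ false)

  -- Odd cycle (k = len c): delete edge d; the remaining path consists of the
  -- edges at cyclic distance j = 1 … k-1 from d; matching b = those with
  -- j % 2 ≡ b; edge r of that matching goes to R, the rest to L.
  OddChoice : Fin (m P) → (L R : Pos P → Bool) → Set
  OddChoice c L R = Σ (Fin (len P c)) λ d → Σ (Fin (len P c)) λ r → Σ ℕ λ b →
    let dist : Fin (len P c) → ℕ
        dist i = cycDist d i
        InM  : Fin (len P c) → Set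
        InM i = dist i ≢ 0 × dist i % 2 ≡ b
    in b ℕ.< 2 × InM r ×
       (∀ i → (R (c , i) ≡ true ⇔ i ≡ r) × (L (c , i) ≡ true ⇔ (InM i × i ≢ r)))

  CycleChoice : Fin (m P) → (L R : Pos P → Bool) → Set
  CycleChoice c L R = (len P c % 2 ≡ 0 → EvenChoice c L R) ×
                      (len P c % 2 ≡ 1 → OddChoice c L R)

  -- X (as a set of cycle edges) is a possible outcome of the random matching.
  -- |S| = 2|L|/3, rounded down or up.
  IsOutcome : (Pos P → Bool) → Set
  IsOutcome X = Σ (Pos P → Bool) λ L → Σ (Pos P → Bool) λ R → Σ (Pos P → Bool) λ S →
    (∀ c → CycleChoice c L R) ×
    (∀ e → S e ≡ true → L e ≡ true) ×
    (countPos S ≡ (2 ℕ.* countPos L) / 3 ⊎ countPos S ≡ (2 ℕ.* countPos L ℕ.+ 2) / 3) ×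
    (∀ e → X e ≡ (S e ∨ R e))

  Covered : (Pos P → Bool) → Fin n → Set
  Covered X v = ∃ λ e → X e ≡ true × (endA P e ≡ v ⊎ endB P e ≡ v)

  InYX : List (HEdge P) → (Pos P → Bool) → HEdge P → Set
  InYX Y X h = h ∈ Y × X (ce h) ≡ true × ¬ Covered X (apex h)

-- The cycle
-- edges chosen by X form a matching, since no two of them are consecutive on a cycle (they lie
-- in one parity class of an even cycle, or of the path left after deleting an edge of an odd
-- cycle), and Y* is a matching of H. Let zx ∈ Y*_X carry the triplet (x,y;z) and let z'x' ∈ Y*_X
-- conflict with it. Then z ≠ z' as Y* is a matching, and neither apex lies on the other cycle
-- edge, for it would be covered by X; so the two cycle edges share a vertex and hence coincide.
-- As Y* is a matching, x' ≠ x, so x' = y: every edge conflicting with zx contains y, and at most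
-- one of them lies in Y*.
module Submission where

open import Defs
open import Data.Nat using (ℕ; zero; suc; _+_; _∸_; _<_; _<?_; s≤s⁻¹)
open import Data.Nat.Properties using (n≤1⇒n≡0∨n≡1; +-comm; suc-injective; 1+n≢0; ≤-antisym; ≮⇒≥)
open import Data.Nat.DivMod using (_%_; m%n<n; m<n⇒m%n≡m; n%n≡0; %-distribˡ-+; m%n%n≡m%n)
open import Data.Nat.Divisibility using (_∣_)
open import Data.Integer using (+_)
open import Data.Rational using (ℚ; 0ℚ; _≤_; _/_)
open import Data.Fin using (Fin; toℕ)
open import Data.Fin.Properties using (toℕ-fromℕ<; toℕ<n; toℕ-injective)
open import Data.Bool using (Bool; true; false; _∨_; if_then_else_)
open import Data.Bool.Properties using (¬-not)
open import Data.Empty using (⊥; ⊥-elim)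
open import Data.Sum as Sum using (_⊎_; inj₁; inj₂)
open import Data.Product using (_×_; _,_; proj₁; proj₂)
open import Data.Product.Properties using (Σ-≡,≡←≡)
open import Data.List using (List)
open import Data.List.Relation.Unary.Any using (here; there)
import Data.List.Relation.Unary.All as All
open import Data.List.Relation.Unary.AllPairs using (AllPairs; _∷_)
open import Data.List.Membership.Propositional using (_∈_)
open import Function.Bundles using (Equivalence)
open import Relation.Binary.PropositionalEquality
  using (_≡_; _≢_; refl; sym; trans; cong; cong₂; subst; module ≡-Reasoning)
open import Relation.Nullary using (yes; no)

%2-suc : ∀ m → suc m % 2 ≢ m % 2
%2-suc zero ()
%2-suc (suc zero) ()
%2-suc (suc (suc m)) = %2-suc m

[m%d+n]%d≡[m+n]%d : ∀ d m n → (m % suc d + n) % suc d ≡ (m + n) % suc d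
[m%d+n]%d≡[m+n]%d d m n = begin
  (m % suc d + n) % suc d                 ≡⟨ %-distribˡ-+ (m % suc d) n (suc d) ⟩
  (m % suc d % suc d + n % suc d) % suc d ≡⟨ cong (λ x → (x + n % suc d) % suc d) (m%n%n≡m%n m (suc d)) ⟩
  (m % suc d + n % suc d) % suc d         ≡⟨ %-distribˡ-+ m n (suc d) ⟨
  (m + n) % suc d                         ∎
  where open ≡-Reasoning

suc[m%d]%d≡suc[m]%d : ∀ d m → suc (m % suc d) % suc d ≡ suc m % suc d
suc[m%d]%d≡suc[m]%d d m = begin
  suc (m % suc d) % suc d ≡⟨ cong (_% suc d) (+-comm 1 (m % suc d)) ⟩
  (m % suc d + 1) % suc d ≡⟨ [m%d+n]%d≡[m+n]%d d m 1 ⟩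
  (m + 1) % suc d         ≡⟨ cong (_% suc d) (+-comm m 1) ⟩
  suc m % suc d           ∎
  where open ≡-Reasoning

suc-%-cases : ∀ d m → m < suc d → suc m % suc d ≡ suc m ⊎ (m ≡ d × suc m % suc d ≡ 0)
suc-%-cases d m m<1+d with suc m <? suc d
... | yes 1+m<1+d = inj₁ (m<n⇒m%n≡m 1+m<1+d)
... | no  1+m≮1+d = inj₂ (m≡d , trans (cong (λ x → suc x % suc d) m≡d) (n%n≡0 (suc d)))
  where
  m≡d : m ≡ d
  m≡d = suc-injective (≤-antisym m<1+d (≮⇒≥ 1+m≮1+d))

toℕ-next : ∀ {k} (i : Fin (suc k)) → toℕ (next i) ≡ suc (toℕ i) % suc k
toℕ-next i = toℕ-fromℕ< _

next-cases : ∀ {k} (i : Fin (suc k)) → toℕ (next i) ≡ suc (toℕ i) ⊎ (toℕ i ≡ k × toℕ (next i) ≡ 0)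
next-cases {k} i with suc-%-cases k (toℕ i) (toℕ<n i)
... | inj₁ no-wrap       = inj₁ (trans (toℕ-next i) no-wrap)
... | inj₂ (i≡k , wrap) = inj₂ (i≡k , trans (toℕ-next i) wrap)

next-injective : ∀ {k} (i j : Fin k) → next i ≡ next j → i ≡ j
next-injective {suc k} i j eq with next-cases i | next-cases j
... | inj₁ p | inj₁ q = toℕ-injective (suc-injective (trans (sym p) (trans (cong toℕ eq) q)))
... | inj₁ p | inj₂ (_ , q) = ⊥-elim (1+n≢0 (trans (sym p) (trans (cong toℕ eq) q)))
... | inj₂ (_ , p) | inj₁ q = ⊥-elim (1+n≢0 (trans (sym q) (trans (cong toℕ (sym eq)) p)))
... | inj₂ (i≡k , _) | inj₂ (j≡k , _) = toℕ-injective (trans i≡k (sym j≡k))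

next-%2-even : ∀ {k} (i : Fin k) → k % 2 ≡ 0 → toℕ (next i) % 2 ≢ toℕ i % 2
next-%2-even {suc k} i k-even with next-cases i
... | inj₁ p = λ eq → %2-suc (toℕ i) (trans (cong (_% 2) (sym p)) eq)
... | inj₂ (i≡k , p) rewrite p | i≡k = λ eq → %2-suc k (trans k-even eq)

cycDist-next : ∀ {k} (d i : Fin (suc k)) → cycDist d (next i) ≡ suc (cycDist d i) % suc k
cycDist-next {k} d i = begin
  (toℕ (next i) + s) % suc k          ≡⟨ cong (λ x → (x + s) % suc k) (toℕ-next i) ⟩
  (suc (toℕ i) % suc k + s) % suc k   ≡⟨ [m%d+n]%d≡[m+n]%d k (suc (toℕ i)) s ⟩
  suc (toℕ i + s) % suc k             ≡⟨ suc[m%d]%d≡suc[m]%d k (toℕ i + s) ⟨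
  suc ((toℕ i + s) % suc k) % suc k   ∎
  where
  open ≡-Reasoning
  s : ℕ
  s = suc k ∸ toℕ d

cycDist-next-%2 : ∀ {k} (d i : Fin k) → cycDist d (next i) ≡ 0 ⊎ cycDist d (next i) % 2 ≢ cycDist d i % 2
cycDist-next-%2 {suc k} d i with suc-%-cases k (cycDist d i) (m%n<n (toℕ i + (suc k ∸ toℕ d)) (suc k))
... | inj₁ p = inj₂ (λ eq → %2-suc (cycDist d i) (trans (cong (_% 2) (sym (trans (cycDist-next d i) p))) eq))
... | inj₂ (_ , p) = inj₁ (trans (cycDist-next d i) p)

∨≡true : ∀ a b → a ∨ b ≡ true → a ≡ true ⊎ b ≡ true
∨≡true true  _ _ = inj₁ refl
∨≡true false _ e = inj₂ e

allPairs-lookup : ∀ {A : Set} {R : A → A → Set} {xs : List A} {x y : A} →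
                  AllPairs R xs → x ∈ xs → y ∈ xs → x ≡ y ⊎ R x y ⊎ R y x
allPairs-lookup _        (here refl) (here refl) = inj₁ refl
allPairs-lookup (rx ∷ _) (here refl) (there y∈) = inj₂ (inj₁ (All.lookup rx y∈))
allPairs-lookup (rx ∷ _) (there x∈)  (here refl) = inj₂ (inj₂ (All.lookup rx x∈))
allPairs-lookup (_ ∷ rs) (there x∈)  (there y∈) = allPairs-lookup rs x∈ y∈

module _ {n : ℕ} (P : CyclePacking n) where

  NoConsecutive : (Pos P → Set) → Set
  NoConsecutive E = ∀ c i → E (c , i) → E (c , next i) → ⊥

  Incident : Pos P → Fin n → Set
  Incident e v = v ≡ endA P e ⊎ v ≡ endB P e

  Chosen : (L R : Pos P → Bool) → Pos P → Set
  Chosen L R e = L e ≡ true ⊎ R e ≡ true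

  evenChoice-noConsecutive : ∀ {c L R} → len P c % 2 ≡ 0 → EvenChoice P c L R →
                             ∀ i → Chosen L R (c , i) → Chosen L R (c , next i) → ⊥
  evenChoice-noConsecutive {c} {L} {R} even (b , _ , choice) i chosen chosen' =
    next-%2-even i even (trans (parity (next i) chosen') (sym (parity i chosen)))
    where
    parity : ∀ j → Chosen L R (c , j) → toℕ j % 2 ≡ b
    parity j (inj₁ l) = Equivalence.to (proj₁ (choice j)) l
    parity j (inj₂ r) with trans (sym r) (proj₂ (choice j))
    ... | ()

  oddChoice-noConsecutive : ∀ {c L R} → OddChoice P c L R →
                            ∀ i → Chosen L R (c , i) → Chosen L R (c , next i) → ⊥
  oddChoice-noConsecutive {c} {L} {R} (d , r , b , _ , r∈M , choice) i chosen chosen' =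
    consecutive (inMatching i chosen) (inMatching (next i) chosen')
    where
    InMatching : Fin (len P c) → Set
    InMatching j = cycDist d j ≢ 0 × cycDist d j % 2 ≡ b

    inMatching : ∀ j → Chosen L R (c , j) → InMatching j
    inMatching j (inj₁ l) = proj₁ (Equivalence.to (proj₂ (choice j)) l)
    inMatching j (inj₂ rj) with Equivalence.to (proj₁ (choice j)) rj
    ... | refl = r∈M

    consecutive : InMatching i → InMatching (next i) → ⊥
    consecutive (_ , parity) (nonzero , parity') =
      Sum.[ nonzero , (λ flips → flips (trans parity' (sym parity))) ] (cycDist-next-%2 d i)

  cycleChoices-noConsecutive : ∀ {L R} → (∀ c → CycleChoice P c L R) → NoConsecutive (Chosen L R)
  cycleChoices-noConsecutive {L} {R} choices c with n≤1⇒n≡0∨n≡1 (s≤s⁻¹ (m%n<n (len P c) 2))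
  ... | inj₁ even = evenChoice-noConsecutive {L = L} {R} even (proj₁ (choices c) even)
  ... | inj₂ odd  = oddChoice-noConsecutive {L = L} {R} (proj₂ (choices c) odd)

  outcome-noConsecutive : ∀ {X} → IsOutcome P X → NoConsecutive (λ e → X e ≡ true)
  outcome-noConsecutive {X} (L , R , S , choices , S⊆L , _ , X≡S∨R) c i x x' =
    cycleChoices-noConsecutive {L} {R} choices c i (chosen x) (chosen x')
    where
    chosen : ∀ {e} → X e ≡ true → Chosen L R e
    chosen {e} x = Sum.map₁ (S⊆L e) (∨≡true (S e) (R e) (trans (sym (X≡S∨R e)) x))

  pos-next-injective : ∀ {c c'} (i : Fin (len P c)) (i' : Fin (len P c')) →
                       _≡_ {A = Pos P} (c , next i) (c' , next i') → (c , i) ≡ (c' , i')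
  pos-next-injective i i' eq with Σ-≡,≡←≡ eq
  ... | refl , next≡ = cong (_ ,_) (next-injective i i' next≡)

  noConsecutive-incident-unique : ∀ {E e e' v} → NoConsecutive E → E e → E e' →
                           Incident e v → Incident e' v → e ≡ e'
  noConsecutive-incident-unique {e = e} {e'} nc x x' (inj₁ p) (inj₁ q) = vtx-injective P e e' (trans (sym p) q)
  noConsecutive-incident-unique {E} {c , i} {c' , i'} nc x x' (inj₁ p) (inj₂ q) =
    ⊥-elim (nc c' i' x' (subst E (vtx-injective P (c , i) (c' , next i') (trans (sym p) q)) x))
  noConsecutive-incident-unique {E} {c , i} {c' , i'} nc x x' (inj₂ p) (inj₁ q) =
    ⊥-elim (nc c i x (subst E (vtx-injective P (c' , i') (c , next i) (trans (sym q) p)) x'))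
  noConsecutive-incident-unique {e = c , i} {c' , i'} nc x x' (inj₂ p) (inj₂ q) =
    pos-next-injective i i' (vtx-injective P (c , next i) (c' , next i') (trans (sym p) q))

  hend-cong : ∀ {h h'} → ce h ≡ ce h' → side h ≡ side h' → hend P h ≡ hend P h'
  hend-cong = cong₂ (λ e s → if s then endA P e else endB P e)

  module _ (W : Weights n) (τ : ℚ) {Y : List (HEdge P)} (matching : IsMatchingH P W τ Y) where

    matchingH-ends-unique : ∀ {h h' v} → h ∈ Y → h' ∈ Y → Ends P h v → Ends P h' v → h ≡ h'
    matchingH-ends-unique {v = v} h∈ h'∈ end end' with allPairs-lookup (proj₂ matching) h∈ h'∈
    ... | inj₁ h≡h'          = h≡h'
    ... | inj₂ (inj₁ apart) = ⊥-elim (apart v end end')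
    ... | inj₂ (inj₂ apart) = ⊥-elim (apart v end' end)

    YX-conflicting⇒other-side : ∀ {X h h'} → NoConsecutive (λ e → X e ≡ true) →
                     InYX P Y X h → InYX P Y X h' → h' ≢ h → Conflicting P h h' →
                     ce h' ≡ ce h × side h' ≢ side h
    YX-conflicting⇒other-side nc (h∈ , _ , _) (h'∈ , _ , _) h'≢h (_ , inj₁ a , inj₁ a') =
      ⊥-elim (h'≢h (matchingH-ends-unique h'∈ h∈ (inj₁ a') (inj₁ a)))
    YX-conflicting⇒other-side {h' = h'} nc (_ , _ , h-free) (_ , h'X , _) _ (_ , inj₁ a , inj₂ t') =
      ⊥-elim (h-free (ce h' , h'X , Sum.map sym sym (subst (Incident (ce h')) a t')))
    YX-conflicting⇒other-side {h = h} nc (_ , hX , _) (_ , _ , h'-free) _ (_ , inj₂ t , inj₁ a') =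
      ⊥-elim (h'-free (ce h , hX , Sum.map sym sym (subst (Incident (ce h)) a' t)))
    YX-conflicting⇒other-side {h = h} {h'} nc (h∈ , hX , _) (h'∈ , h'X , _) h'≢h (_ , inj₂ t , inj₂ t') =
      ce≡ , λ side≡ → h'≢h (matchingH-ends-unique h'∈ h∈ (inj₂ (sym (hend-cong {h'} {h} ce≡ side≡))) (inj₂ refl))
      where
      ce≡ : ce h' ≡ ce h
      ce≡ = noConsecutive-incident-unique nc h'X hX t' t

lemma10 : (n : ℕ) → 3 ∣ n → (W : Weights n) → (P : CyclePacking n) →
          (τ : ℚ) → 0ℚ ≤ τ → τ ≤ (+ 1) / 3 →
          (Y : List (HEdge P)) → IsMaxMatchingH P W τ Y →
          (X : Pos P → Bool) → IsOutcome P X →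
          (h : HEdge P) → InYX P Y X h →
          (h₁ h₂ : HEdge P) → InYX P Y X h₁ → InYX P Y X h₂ →
          h₁ ≢ h → h₂ ≢ h → Conflicting P h h₁ → Conflicting P h h₂ →
          h₁ ≡ h₂
lemma10 n _ W P τ _ _ Y (matching , _) X outcome h h∈YX h₁ h₂ h₁∈YX h₂∈YX h₁≢h h₂≢h conflict₁ conflict₂ =
  matchingH-ends-unique P W τ matching (proj₁ h₁∈YX) (proj₁ h₂∈YX) (inj₂ refl) (inj₂ same-end)
  where
  X-noConsecutive : NoConsecutive P (λ e → X e ≡ true)
  X-noConsecutive = outcome-noConsecutive P outcome

  same-edge₁ : ce h₁ ≡ ce h × side h₁ ≢ side h
  same-edge₁ = YX-conflicting⇒other-side P W τ matching X-noConsecutive h∈YX h₁∈YX h₁≢h conflict₁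

  same-edge₂ : ce h₂ ≡ ce h × side h₂ ≢ side h
  same-edge₂ = YX-conflicting⇒other-side P W τ matching X-noConsecutive h∈YX h₂∈YX h₂≢h conflict₂

  same-end : hend P h₁ ≡ hend P h₂
  same-end = hend-cong P {h₁} {h₂} (trans (proj₁ same-edge₁) (sym (proj₁ same-edge₂)))
                                   (trans (¬-not (proj₂ same-edge₁)) (sym (¬-not (proj₂ same-edge₂))))
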